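{- Let $t_c,t_m$ be positive integers. For every integer $R\ge t_c+t_m$, $N^*(R)\ge N^*(R-t_c)+N^*(R-t_c-t_m)$.
   Context: Token Network model: an undirected graph $G$ with integers $t_c,t_m$; synchronous rounds; each node starts with one token. A non-busy node holding $\ge1$ token may communicate (busy $t_m$ rounds, then one token is delivered to a neighbor); a non-busy node holding $\ge 2$ tokens may compute (busy $t_c$ rounds, then two of its tokens are replaced by one). A node may receive from several neighbors in one round. A schedule is valid if all actions are legal and at its end exactly one token remains; \textsc{Token Computation} asks for a valid schedule. $N^*(R)$ denotes the size of the largest complete graph $K_m$ such that \textsc{Token Computation} on $(K_m,t_c,t_m)$ can be solved by a valid schedule of length $R$. -}

module Defs where

open import Data.Nat using (ℕ; zero; suc; _+_; _∸_; _≤_)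
open import Data.Fin using (Fin; zero; suc; _≟_)
open import Data.Product using (Σ; ∃; _×_; _,_)
open import Data.Unit using (⊤)
open import Relation.Nullary using (¬_; yes; no)
open import Relation.Binary.PropositionalEquality using (_≡_)

-- Token Network on the complete graph K_m, with parameters tc (compute time)
-- and tm (communication time). Nodes are Fin m; in K_m every u ≠ v is a neighbour.

sumFin : (m : ℕ) → (Fin m → ℕ) → ℕ
sumFin zero    f = 0
sumFin (suc m) f = f zero + sumFin m (λ i → f (suc i))

-- What a node is doing: nothing, sending a token to u (rem rounds left),
-- or computing (rem rounds left).
data Job (m : ℕ) : Set where
  free    : Job m
  commJob : Fin m → ℕ → Job m
  compJob : ℕ → Job m

record NodeState (m : ℕ) : Set where
  constructor ⟨_,_⟩
  field
    tokens : ℕ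
    job    : Job m
open NodeState public

State : ℕ → Set
State m = Fin m → NodeState m

initial : (m : ℕ) → State m
initial m v = ⟨ 1 , free ⟩

data Choice (m : ℕ) : Set where
  idle : Choice m
  comm : Fin m → Choice m
  comp : Choice m           -- start merging two of its tokens

Legal : {m : ℕ} → Fin m → NodeState m → Choice m → Set
Legal v st idle     = ⊤
Legal v st (comm u) = (job st ≡ free) × (1 ≤ tokens st) × ¬ (u ≡ v)
Legal v st comp     = (job st ≡ free) × (2 ≤ tokens st)

-- Phase 1 of a round: starting actions (tokens leave / are consumed at start).
start : {m : ℕ} → (tc tm : ℕ) → NodeState m → Choice m → NodeState m
start tc tm st idle     = st
start tc tm st (comm u) = ⟨ tokens st ∸ 1 , commJob u tm ⟩
start tc tm st comp     = ⟨ tokens st ∸ 2 , compJob tc ⟩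

-- Phase 2: every busy node spends one round; jobs with 1 round left complete.
tick : {m : ℕ} → Job m → Job m
tick free            = free
tick (commJob u (suc (suc r))) = commJob u (suc r)
tick (commJob u _)   = free
tick (compJob (suc (suc r))) = compJob (suc r)
tick (compJob _)     = free

compDone : {m : ℕ} → Job m → ℕ
compDone (compJob 1) = 1
compDone _           = 0

delivers : {m : ℕ} → Fin m → Job m → ℕ
delivers v (commJob u 1) with u ≟ v
... | yes _ = 1
... | no  _ = 0
delivers v _ = 0

next : {m : ℕ} → (tc tm : ℕ) → State m → (Fin m → Choice m) → State m
next {m} tc tm s c v =
  ⟨ tokens (s1 v) + compDone (job (s1 v)) + sumFin m (λ u → delivers v (job (s1 u)))
  , tick (job (s1 v)) ⟩
  where
    s1 : Fin m → NodeState m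
    s1 u = start tc tm (s u) (c u)

data Reaches {m : ℕ} (tc tm : ℕ) : State m → ℕ → State m → Set where
  done : ∀ {s} → Reaches tc tm s 0 s
  step : ∀ {s R s'} (c : Fin m → Choice m) →
         (∀ v → Legal v (s v) (c v)) →
         Reaches tc tm (next tc tm s c) R s' →
         Reaches tc tm s (suc R) s'

Final : {m : ℕ} → State m → Set
Final {m} s = (∀ v → job (s v) ≡ free) × (sumFin m (λ v → tokens (s v)) ≡ 1)

Solvable : (tc tm m R : ℕ) → Set
Solvable tc tm m R = Σ (State m) λ s → Reaches tc tm (initial m) R s × Final s

IsNStar : (tc tm R n : ℕ) → Set
IsNStar tc tm R n = Solvable tc tm n R × (∀ m → Solvable tc tm m R → m ≤ n)

-- Split K_(a+b) into a copy of K_a and a copy of K_b and let k = R - tc - tm. For the first k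
-- rounds both copies run their own schedules side by side (they never exchange tokens), after
-- which the K_b copy is done and holds its single token at some node w. In the next tm rounds the
-- K_a copy runs the rest of its schedule of length k + tm while w sends its token to the node y
-- where that schedule leaves its token; the message lands exactly when the schedule ends. In the
-- last tc rounds y merges its two tokens, so K_(a+b) is solved in k + tm + tc = R rounds.

module Submission where

open import Defs
open import Data.Bool using (if_then_else_)
open import Data.Bool.Properties using (if-float; if-eta)
open import Data.Nat using (ℕ; zero; suc; _+_; _∸_; _≤_; z≤n; s≤s)
open import Data.Nat.Properties
  using (+-assoc; +-comm; +-identityʳ; +-cancelʳ-≡; +-monoˡ-≤; ≤-reflexive;
         m∸n+n≡m; m+n≤o⇒m≤o; m+n≤o⇒m≤o∸n)
open import Function using (_∘_)
open import Data.Fin as Fin using (Fin; _↑ˡ_; _↑ʳ_; splitAt; join; _≟_)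
open import Data.Fin.Properties
  using (suc-injective; ↑ˡ-injective; ↑ʳ-injective; splitAt-↑ˡ; splitAt-↑ʳ; join-splitAt)
open import Data.Vec.Functional using (map; _++_)
open import Data.Vec.Functional.Properties using (lookup-++ˡ; lookup-++ʳ)
open import Data.Product using (Σ; ∃; _×_; _,_; proj₁; proj₂)
open import Data.Sum using (inj₁; inj₂)
open import Data.Unit using (tt)
open import Relation.Nullary using (does; yes; no; contradiction)
open import Relation.Nullary.Decidable using (dec-true; dec-false)
open import Relation.Binary.PropositionalEquality

onlyAt : ∀ {m} {A : Set} → Fin m → A → A → Fin m → A
onlyAt v x d u = if does (v ≟ u) then x else d

onlyAt-here : ∀ {m} {A : Set} (v : Fin m) {x d : A} → onlyAt v x d v ≡ x
onlyAt-here v {x} {d} = cong (if_then x else d) (dec-true (v ≟ v) refl)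

onlyAt-there : ∀ {m} {A : Set} {v u : Fin m} {x d : A} → u ≢ v → onlyAt v x d u ≡ d
onlyAt-there {v = v} {u} {x} {d} u≢v = cong (if_then x else d) (dec-false (v ≟ u) (u≢v ∘ sym))

onlyAt-float : ∀ {m} {A B : Set} (f : A → B) (v u : Fin m) {x d : A} →
               f (onlyAt v x d u) ≡ onlyAt v (f x) (f d) u
onlyAt-float f v u = if-float f (does (v ≟ u))

onlyAt-same : ∀ {m} {A : Set} (v u : Fin m) {x : A} → onlyAt v x x u ≡ x
onlyAt-same v u = if-eta (does (v ≟ u))

sumFin-cong : ∀ m {f g : Fin m → ℕ} → (∀ i → f i ≡ g i) → sumFin m f ≡ sumFin m g
sumFin-cong zero    f≗g = refl
sumFin-cong (suc m) f≗g = cong₂ _+_ (f≗g Fin.zero) (sumFin-cong m (f≗g ∘ Fin.suc))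

sumFin-zero : ∀ m {f : Fin m → ℕ} → (∀ i → f i ≡ 0) → sumFin m f ≡ 0
sumFin-zero zero    f≗0 = refl
sumFin-zero (suc m) f≗0 = cong₂ _+_ (f≗0 Fin.zero) (sumFin-zero m (f≗0 ∘ Fin.suc))

sumFin-++ : ∀ a b (f : Fin (a + b) → ℕ) →
            sumFin (a + b) f ≡ sumFin a (λ i → f (i ↑ˡ b)) + sumFin b (λ j → f (a ↑ʳ j))
sumFin-++ zero    b f = refl
sumFin-++ (suc a) b f =
  trans (cong (f Fin.zero +_) (sumFin-++ a b (f ∘ Fin.suc))) (sym (+-assoc (f Fin.zero) _ _))

sumFin-bumpAt : ∀ m {f g : Fin m → ℕ} (v : Fin m) {k : ℕ} → f v ≡ g v + k →
                (∀ u → u ≢ v → f u ≡ g u) → sumFin m f ≡ sumFin m g + k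
sumFin-bumpAt (suc m) {f} {g} Fin.zero {k} fv≡gv+k f≗g =
  begin
    f Fin.zero + sumFin m (f ∘ Fin.suc)
      ≡⟨ cong₂ _+_ fv≡gv+k (sumFin-cong m (λ i → f≗g (Fin.suc i) λ ())) ⟩
    g Fin.zero + k + sumFin m (g ∘ Fin.suc)     ≡⟨ +-assoc (g Fin.zero) k _ ⟩
    g Fin.zero + (k + sumFin m (g ∘ Fin.suc))   ≡⟨ cong (g Fin.zero +_) (+-comm k _) ⟩
    g Fin.zero + (sumFin m (g ∘ Fin.suc) + k)   ≡⟨ sym (+-assoc (g Fin.zero) _ k) ⟩
    g Fin.zero + sumFin m (g ∘ Fin.suc) + k     ∎
  where open ≡-Reasoning
sumFin-bumpAt (suc m) {f} {g} (Fin.suc v) {k} fv≡gv+k f≗g =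
  trans (cong₂ _+_ (f≗g Fin.zero λ ())
                   (sumFin-bumpAt m v fv≡gv+k (λ u u≢v → f≗g (Fin.suc u) (u≢v ∘ suc-injective))))
        (sym (+-assoc (g Fin.zero) _ k))

sumFin-takeAt : ∀ m (f : Fin m → ℕ) (v : Fin m) {d : ℕ} → d ≤ f v →
                sumFin m (λ u → f u ∸ onlyAt v d 0 u) + d ≡ sumFin m f
sumFin-takeAt m f v {d} d≤fv = sym (sumFin-bumpAt m v at-v elsewhere)
  where
  at-v : f v ≡ f v ∸ onlyAt v d 0 v + d
  at-v = trans (sym (m∸n+n≡m d≤fv)) (cong (λ e → f v ∸ e + d) (sym (onlyAt-here v)))
  elsewhere : ∀ u → u ≢ v → f u ≡ f u ∸ onlyAt v d 0 u
  elsewhere u u≢v = cong (f u ∸_) (sym (onlyAt-there u≢v))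

sumFin-+-onlyAt : ∀ m (f : Fin m → ℕ) (v : Fin m) {k : ℕ} →
                  sumFin m (λ u → f u + onlyAt v k 0 u) ≡ sumFin m f + k
sumFin-+-onlyAt m f v {k} =
  sumFin-bumpAt m v (cong (f v +_) (onlyAt-here v))
                    (λ u u≢v → trans (cong (f u +_) (onlyAt-there u≢v)) (+-identityʳ (f u)))

sumFin-onlyAt : ∀ m (v : Fin m) {k : ℕ} → sumFin m (onlyAt v k 0) ≡ k
sumFin-onlyAt m v {k} = trans (sumFin-+-onlyAt m (λ _ → 0) v) (cong (_+ k) (sumFin-zero m λ _ → refl))

sumFin-positive : ∀ m (f : Fin m → ℕ) → 1 ≤ sumFin m f → ∃ λ w → 1 ≤ f w
sumFin-positive (suc m) f 1≤Σf with f Fin.zero in f0≡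
... | suc _ = Fin.zero , subst (1 ≤_) (sym f0≡) (s≤s z≤n)
... | zero with sumFin-positive m (f ∘ Fin.suc) 1≤Σf
...   | w , 1≤fw = Fin.suc w , 1≤fw

Reaches-++ : ∀ {m tc tm} {s s′ s″ : State m} {k l} →
             Reaches tc tm s k s′ → Reaches tc tm s′ l s″ → Reaches tc tm s (k + l) s″
Reaches-++ done          r′ = r′
Reaches-++ (step c ok r) r′ = step c ok (Reaches-++ r r′)

Reaches-split : ∀ {m tc tm} k {l} {s s″ : State m} → Reaches tc tm s (k + l) s″ →
                ∃ λ s′ → Reaches tc tm s k s′ × Reaches tc tm s′ l s″
Reaches-split zero    r             = _ , done , r
Reaches-split (suc k) (step c ok r) with Reaches-split k r
... | s′ , r₁ , r₂ = s′ , step c ok r₁ , r₂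

step-∃ : ∀ {m tc tm} {P : State m → Set} {s : State m} {R} c → (∀ v → Legal v (s v) (c v)) →
         (∃ λ s′ → Reaches tc tm (next tc tm s c) R s′ × P s′) →
         ∃ λ s′ → Reaches tc tm s (suc R) s′ × P s′
step-∃ c ok (s′ , r , p) = s′ , step c ok r , p

AllFree : ∀ {m} → State m → Set
AllFree {m} s = ∀ (u : Fin m) → job (s u) ≡ free

delivers-arriving : ∀ {m} (x y : Fin m) → delivers x (commJob y 1) ≡ onlyAt y 1 0 x
delivers-arriving x y with y ≟ x
... | yes _ = refl
... | no  _ = refl

relabelJob : ∀ {m n} → (Fin m → Fin n) → Job m → Job n
relabelJob e free          = free
relabelJob e (commJob u r) = commJob (e u) r
relabelJob e (compJob r)   = compJob r

relabelChoice : ∀ {m n} → (Fin m → Fin n) → Choice m → Choice n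
relabelChoice e idle     = idle
relabelChoice e (comm u) = comm (e u)
relabelChoice e comp     = comp

module _ {m n : ℕ} (e : Fin m → Fin n) where

  tick-relabel : ∀ j → tick (relabelJob e j) ≡ relabelJob e (tick j)
  tick-relabel free                      = refl
  tick-relabel (commJob u zero)          = refl
  tick-relabel (commJob u (suc zero))    = refl
  tick-relabel (commJob u (suc (suc r))) = refl
  tick-relabel (compJob zero)            = refl
  tick-relabel (compJob (suc zero))      = refl
  tick-relabel (compJob (suc (suc r)))   = refl

  compDone-relabel : ∀ j → compDone (relabelJob e j) ≡ compDone j
  compDone-relabel free                    = refl
  compDone-relabel (commJob u r)           = refl
  compDone-relabel (compJob zero)          = refl
  compDone-relabel (compJob (suc zero))    = refl
  compDone-relabel (compJob (suc (suc r))) = refl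

  delivers-relabel : (∀ u v → e u ≡ e v → u ≡ v) →
                     ∀ v j → delivers (e v) (relabelJob e j) ≡ delivers v j
  delivers-relabel e-inj v free                      = refl
  delivers-relabel e-inj v (compJob r)               = refl
  delivers-relabel e-inj v (commJob u zero)          = refl
  delivers-relabel e-inj v (commJob u (suc (suc r))) = refl
  delivers-relabel e-inj v (commJob u (suc zero)) with e u ≟ e v | u ≟ v
  ... | yes _     | yes _   = refl
  ... | no  _     | no  _   = refl
  ... | yes eu≡ev | no u≢v  = contradiction (e-inj u v eu≡ev) u≢v
  ... | no eu≢ev  | yes u≡v = contradiction (cong e u≡v) eu≢ev

  delivers-outside : ∀ x → (∀ u → e u ≢ x) → ∀ j → delivers x (relabelJob e j) ≡ 0
  delivers-outside x x∉e free                      = refl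
  delivers-outside x x∉e (compJob r)               = refl
  delivers-outside x x∉e (commJob u zero)          = refl
  delivers-outside x x∉e (commJob u (suc (suc r))) = refl
  delivers-outside x x∉e (commJob u (suc zero)) with e u ≟ x
  ... | yes eu≡x = contradiction eu≡x (x∉e u)
  ... | no  _    = refl

module Embedding {n a b : ℕ} (tc tm : ℕ) (e : Fin a → Fin n) (e′ : Fin b → Fin n)
  (e-injective : ∀ u v → e u ≡ e v → u ≡ v) (disjoint : ∀ i j → e′ j ≢ e i)
  (sumFin-split : ∀ f → sumFin n f ≡ sumFin a (f ∘ e) + sumFin b (f ∘ e′)) where

  infix 4 _≅_
  _≅_ : NodeState n → NodeState a → Set
  st ≅ stA = tokens st ≡ tokens stA × job st ≡ relabelJob e (job stA)

  Embeds : State n → State a → Set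
  Embeds s sA = ∀ i → s (e i) ≅ sA i

  start-≅ : ∀ {st stA} → st ≅ stA → ∀ ch → start tc tm st (relabelChoice e ch) ≅ start tc tm stA ch
  start-≅ st≅stA           idle     = st≅stA
  start-≅ (tokens≡ , _)    (comm u) = cong (_∸ 1) tokens≡ , refl
  start-≅ (tokens≡ , _)    comp     = cong (_∸ 2) tokens≡ , refl

  Legal-≅ : ∀ {st stA} i → st ≅ stA → ∀ ch → Legal i stA ch → Legal (e i) st (relabelChoice e ch)
  Legal-≅ i _                    idle     _                   = tt
  Legal-≅ i (tokens≡ , job≡) (comm u) (free≡ , 1≤ , u≢i) =
    trans job≡ (cong (relabelJob e) free≡) , subst (1 ≤_) (sym tokens≡) 1≤ , u≢i ∘ e-injective u i
  Legal-≅ i (tokens≡ , job≡) comp     (free≡ , 2≤)        =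
    trans job≡ (cong (relabelJob e) free≡) , subst (2 ≤_) (sym tokens≡) 2≤

  module Round (s : State n) (sA : State a) (c : Fin n → Choice n) (cA : Fin a → Choice a)
               (s≅sA : Embeds s sA) (c≡cA : ∀ i → c (e i) ≡ relabelChoice e (cA i)) where

    started : ∀ i → start tc tm (s (e i)) (c (e i)) ≅ start tc tm (sA i) (cA i)
    started i = subst (λ ch → start tc tm (s (e i)) ch ≅ _) (sym (c≡cA i)) (start-≅ (s≅sA i) (cA i))

    jobA : Fin a → Job a
    jobA u = job (start tc tm (sA u) (cA u))

    inflow-from-e′ : Fin a → ℕ
    inflow-from-e′ i = sumFin b (λ u → delivers (e i) (job (start tc tm (s (e′ u)) (c (e′ u)))))

    next-tokens : ∀ i → tokens (next tc tm s c (e i)) ≡ tokens (next tc tm sA cA i) + inflow-from-e′ i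
    next-tokens i =
      trans (cong₂ _+_ (cong₂ _+_ (proj₁ (started i)) compDone≡) inflow≡)
            (sym (+-assoc (tokens (start tc tm (sA i) (cA i)) + compDone (jobA i)) _ (inflow-from-e′ i)))
      where
      compDone≡ : compDone (job (start tc tm (s (e i)) (c (e i)))) ≡ compDone (jobA i)
      compDone≡ = trans (cong compDone (proj₂ (started i))) (compDone-relabel e (jobA i))
      inflow≡ : sumFin n (λ u → delivers (e i) (job (start tc tm (s u) (c u))))
              ≡ sumFin a (λ u → delivers i (jobA u)) + inflow-from-e′ i
      inflow≡ = trans (sumFin-split (λ u → delivers (e i) (job (start tc tm (s u) (c u)))))
                      (cong (_+ inflow-from-e′ i) (sumFin-cong a λ u →
                         trans (cong (delivers (e i)) (proj₂ (started u)))
                               (delivers-relabel e e-injective i (jobA u))))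

    next-job : ∀ i → job (next tc tm s c (e i)) ≡ relabelJob e (job (next tc tm sA cA i))
    next-job i = trans (cong tick (proj₂ (started i))) (tick-relabel e (jobA i))

    legal : (∀ i → Legal i (sA i) (cA i)) → ∀ i → Legal (e i) (s (e i)) (c (e i))
    legal ok i = subst (Legal (e i) (s (e i))) (sym (c≡cA i)) (Legal-≅ i (s≅sA i) (cA i) (ok i))

    isolated : (∀ u → Σ (Job b) λ j → job (start tc tm (s (e′ u)) (c (e′ u))) ≡ relabelJob e′ j) →
               ∀ i → tokens (next tc tm s c (e i)) ≡ tokens (next tc tm sA cA i)
    isolated jobs′ i = trans (next-tokens i) (trans (cong (_ +_) no-inflow) (+-identityʳ _))
      where
      no-inflow : inflow-from-e′ i ≡ 0
      no-inflow = sumFin-zero b λ u → trans (cong (delivers (e i)) (proj₂ (jobs′ u)))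
                                            (delivers-outside e′ (e i) (λ j → disjoint i j) (proj₁ (jobs′ u)))

module _ {m : ℕ} (tm : ℕ) (v : Fin m) where

  private
    computing : ℕ → Fin m → Job m
    computing r = onlyAt v (compJob r) free

    no-delivery : ∀ x r u → delivers x (computing r u) ≡ 0
    no-delivery x r u = trans (onlyAt-float (delivers x) v u) (onlyAt-same v u)

    quiet-tokens : ∀ tc s c r → (∀ u → job (start tc tm (s u) (c u)) ≡ computing r u) →
                   ∀ u → tokens (next tc tm s c u) ≡ tokens (start tc tm (s u) (c u)) + compDone (computing r u)
    quiet-tokens tc s c r jobs u =
      trans (cong₂ _+_ (cong (λ j → tokens (start tc tm (s u) (c u)) + compDone j) (jobs u))
                       (sumFin-zero m λ w → trans (cong (delivers u) (jobs w)) (no-delivery u r w)))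
            (+-identityʳ _)

  -- The hypotheses describe the first round once its actions have started, so the round that
  -- launches the computation and the idle rounds after it are handled alike.
  countdown : ∀ tc r (t : Fin m → ℕ) (s : State m) (c : Fin m → Choice m) →
              (∀ u → Legal u (s u) (c u)) →
              (∀ u → tokens (start tc tm (s u) (c u)) ≡ t u) →
              (∀ u → job (start tc tm (s u) (c u)) ≡ computing (suc r) u) →
              ∃ λ s′ → Reaches tc tm s (suc r) s′ × AllFree s′ × sumFin m (tokens ∘ s′) ≡ sumFin m t + 1
  countdown tc zero t s c ok toks jobs =
    next tc tm s c , step c ok done , freed , trans (sumFin-cong m gains-at-v) (sumFin-+-onlyAt m t v)
    where
    freed : AllFree (next tc tm s c)
    freed u = trans (cong tick (jobs u)) (trans (onlyAt-float tick v u) (onlyAt-same v u))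
    gains-at-v : ∀ u → tokens (next tc tm s c u) ≡ t u + onlyAt v 1 0 u
    gains-at-v u = trans (quiet-tokens tc s c 1 jobs u) (cong₂ _+_ (toks u) (onlyAt-float compDone v u))
  countdown tc (suc r) t s c ok toks jobs =
    step-∃ c ok (countdown tc r t (next tc tm s c) (λ _ → idle) (λ _ → tt) waits ticks)
    where
    waits : ∀ u → tokens (next tc tm s c u) ≡ t u
    waits u = trans (quiet-tokens tc s c (suc (suc r)) jobs u)
                    (trans (cong₂ _+_ (toks u) (trans (onlyAt-float compDone v u) (onlyAt-same v u)))
                           (+-identityʳ (t u)))
    ticks : ∀ u → job (next tc tm s c u) ≡ computing (suc r) u
    ticks u = trans (cong tick (jobs u)) (onlyAt-float tick v u)

  merge : ∀ tc′ (s : State m) → AllFree s → 2 ≤ tokens (s v) →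
          ∃ λ s′ → Reaches (suc tc′) tm s (suc tc′) s′ × AllFree s′ ×
                   sumFin m (tokens ∘ s′) + 1 ≡ sumFin m (tokens ∘ s)
  merge tc′ s free-s 2≤ =
    let s′ , r , free-s′ , Σs′≡Σremaining+1 = countdown (suc tc′) tc′ remaining s c ok toks jobs
    in  s′ , r , free-s′ ,
        trans (cong (_+ 1) Σs′≡Σremaining+1) (trans (+-assoc _ 1 1) (sumFin-takeAt m (tokens ∘ s) v 2≤))
    where
    c : Fin m → Choice m
    c = onlyAt v comp idle
    remaining : Fin m → ℕ
    remaining u = tokens (s u) ∸ onlyAt v 2 0 u
    ok : ∀ u → Legal u (s u) (c u)
    ok u with v ≟ u
    ... | yes refl = free-s v , 2≤
    ... | no  _    = tt
    toks : ∀ u → tokens (start (suc tc′) tm (s u) (c u)) ≡ remaining u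
    toks u with v ≟ u
    ... | yes _ = refl
    ... | no  _ = refl
    jobs : ∀ u → job (start (suc tc′) tm (s u) (c u)) ≡ computing (suc tc′) u
    jobs u with v ≟ u
    ... | yes _ = refl
    ... | no  _ = free-s u

↑ˡ≢↑ʳ : ∀ {a b} (i : Fin a) (j : Fin b) → i ↑ˡ b ≢ a ↑ʳ j
↑ˡ≢↑ʳ {a} {b} i j eq with trans (sym (splitAt-↑ˡ a i b)) (trans (cong (splitAt a) eq) (splitAt-↑ʳ a b j))
... | ()

↑-elim : ∀ {a b} (P : Fin (a + b) → Set) → (∀ i → P (i ↑ˡ b)) → (∀ j → P (a ↑ʳ j)) → ∀ v → P v
↑-elim {a} {b} P Pˡ Pʳ v = subst P (join-splitAt a b v) (by-part (splitAt a v))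
  where
  by-part : ∀ x → P (join a b x)
  by-part (inj₁ i) = Pˡ i
  by-part (inj₂ j) = Pʳ j

module TwoParts {a b : ℕ} (tc tm : ℕ) where

  module Left  = Embedding tc tm (_↑ˡ b) (a ↑ʳ_) (↑ˡ-injective b) (λ i j → ↑ˡ≢↑ʳ i j ∘ sym) (sumFin-++ a b)
  module Right = Embedding tc tm (a ↑ʳ_) (_↑ˡ b) (↑ʳ-injective a) (λ j i → ↑ˡ≢↑ʳ i j)
                           (λ f → trans (sumFin-++ a b f) (+-comm (sumFin a (f ∘ (_↑ˡ b))) _))

  _◁_ : (Fin a → Choice a) → (Fin b → Choice (a + b)) → Fin (a + b) → Choice (a + b)
  cA ◁ cR = map (relabelChoice (_↑ˡ b)) cA ++ cR

  _⊗_ : (Fin a → Choice a) → (Fin b → Choice b) → Fin (a + b) → Choice (a + b)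
  cA ⊗ cB = cA ◁ map (relabelChoice (a ↑ʳ_)) cB

  parallel-round : ∀ {s sA sB} {cA cB} → Left.Embeds s sA → Right.Embeds s sB →
                   (∀ i → Legal i (sA i) (cA i)) → (∀ j → Legal j (sB j) (cB j)) →
                   (∀ v → Legal v (s v) ((cA ⊗ cB) v)) ×
                   Left.Embeds (next tc tm s (cA ⊗ cB)) (next tc tm sA cA) ×
                   Right.Embeds (next tc tm s (cA ⊗ cB)) (next tc tm sB cB)
  parallel-round {s} {sA} {sB} {cA} {cB} s≅sA s≅sB okA okB =
    ↑-elim _ (L.legal okA) (R.legal okB) ,
    (λ i → L.isolated (λ u → _ , proj₂ (R.started u)) i , L.next-job i) ,
    (λ j → R.isolated (λ u → _ , proj₂ (L.started u)) j , R.next-job j)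
    where
    module L = Left.Round  s sA (cA ⊗ cB) cA s≅sA (lookup-++ˡ (map (relabelChoice (_↑ˡ b)) cA) _)
    module R = Right.Round s sB (cA ⊗ cB) cB s≅sB (lookup-++ʳ (map (relabelChoice (_↑ˡ b)) cA) _)

  parallel : ∀ k {s sA sA′ sB sB′} → Reaches tc tm sA k sA′ → Reaches tc tm sB k sB′ →
             Left.Embeds s sA → Right.Embeds s sB →
             ∃ λ s′ → Reaches tc tm s k s′ × Left.Embeds s′ sA′ × Right.Embeds s′ sB′
  parallel zero    done             done             s≅sA s≅sB = _ , done , s≅sA , s≅sB
  parallel (suc k) (step cA okA rA) (step cB okB rB) s≅sA s≅sB =
    let ok , s≅sA′ , s≅sB′ = parallel-round s≅sA s≅sB okA okB
    in  step-∃ (cA ⊗ cB) ok (parallel k rA rB s≅sA′ s≅sB′)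

  module Sending (y : Fin a) (w : Fin b) where

    sending : ℕ → Fin b → Job (a + b)
    sending r = onlyAt w (commJob (y ↑ˡ b) r) free

    module Round (r : ℕ) (s : State (a + b)) (sA : State a) (cA : Fin a → Choice a)
                 (cB : Fin b → Choice (a + b)) (tB : Fin b → ℕ) (s≅sA : Left.Embeds s sA)
                 (tokens-B : ∀ j → tokens (start tc tm (s (a ↑ʳ j)) (cB j)) ≡ tB j)
                 (jobs-B : ∀ j → job (start tc tm (s (a ↑ʳ j)) (cB j)) ≡ sending (suc r) j) where

      c : Fin (a + b) → Choice (a + b)
      c = cA ◁ cB

      c≡cB : ∀ j → c (a ↑ʳ j) ≡ cB j
      c≡cB = lookup-++ʳ (map (relabelChoice (_↑ˡ b)) cA) cB

      module L = Left.Round s sA c cA s≅sA (lookup-++ˡ (map (relabelChoice (_↑ˡ b)) cA) cB)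

      jobs-B′ : ∀ j → job (start tc tm (s (a ↑ʳ j)) (c (a ↑ʳ j))) ≡ sending (suc r) j
      jobs-B′ j = trans (cong (λ ch → job (start tc tm (s (a ↑ʳ j)) ch)) (c≡cB j)) (jobs-B j)

      legal : (∀ i → Legal i (sA i) (cA i)) → (∀ j → Legal (a ↑ʳ j) (s (a ↑ʳ j)) (cB j)) →
              ∀ v → Legal v (s v) (c v)
      legal okA okB =
        ↑-elim _ (L.legal okA) (λ j → subst (Legal (a ↑ʳ j) (s (a ↑ʳ j))) (sym (c≡cB j)) (okB j))

      left-tokens : ∀ i → tokens (next tc tm s c (i ↑ˡ b)) ≡
                          tokens (next tc tm sA cA i) + delivers (i ↑ˡ b) (commJob (y ↑ˡ b) (suc r))
      left-tokens i = trans (L.next-tokens i) (cong (_ +_) (trans (sumFin-cong b at-w) (sumFin-onlyAt b w)))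
        where
        at-w : ∀ j → delivers (i ↑ˡ b) (job (start tc tm (s (a ↑ʳ j)) (c (a ↑ʳ j))))
                   ≡ onlyAt w (delivers (i ↑ˡ b) (commJob (y ↑ˡ b) (suc r))) 0 j
        at-w j = trans (cong (delivers (i ↑ˡ b)) (jobs-B′ j)) (onlyAt-float (delivers (i ↑ˡ b)) w j)

      right-tokens : ∀ j → tokens (next tc tm s c (a ↑ʳ j)) ≡ tB j
      right-tokens j =
        trans (cong₂ _+_ (cong₂ _+_ tokens≡ compDone≡) no-inflow)
              (trans (+-identityʳ _) (+-identityʳ (tB j)))
        where
        tokens≡ : tokens (start tc tm (s (a ↑ʳ j)) (c (a ↑ʳ j))) ≡ tB j
        tokens≡ = trans (cong (λ ch → tokens (start tc tm (s (a ↑ʳ j)) ch)) (c≡cB j)) (tokens-B j)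
        compDone≡ : compDone (job (start tc tm (s (a ↑ʳ j)) (c (a ↑ʳ j)))) ≡ 0
        compDone≡ = trans (cong compDone (jobs-B′ j)) (trans (onlyAt-float compDone w j) (onlyAt-same w j))
        outside-A : ∀ i → i ↑ˡ b ≢ a ↑ʳ j
        outside-A i = ↑ˡ≢↑ʳ i j
        no-inflow : sumFin (a + b) (λ u → delivers (a ↑ʳ j) (job (start tc tm (s u) (c u)))) ≡ 0
        no-inflow = trans (sumFin-++ a b _) (cong₂ _+_
          (sumFin-zero a λ u → trans (cong (delivers (a ↑ʳ j)) (proj₂ (L.started u)))
                                     (delivers-outside (_↑ˡ b) (a ↑ʳ j) outside-A (L.jobA u)))
          (sumFin-zero b λ u → trans (cong (delivers (a ↑ʳ j)) (jobs-B′ u))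
                                     (trans (onlyAt-float (delivers (a ↑ʳ j)) w u)
                                            (trans (cong (λ k → onlyAt w k 0 u) (delivers-outside (_↑ˡ b)
                                                      (a ↑ʳ j) outside-A (commJob y (suc r))))
                                                   (onlyAt-same w u)))))

      right-job : ∀ j → job (next tc tm s c (a ↑ʳ j)) ≡ onlyAt w (tick (commJob (y ↑ˡ b) (suc r))) free j
      right-job j = trans (cong tick (jobs-B′ j)) (onlyAt-float tick w j)

    Landed : State a → (Fin b → ℕ) → State (a + b) → Set
    Landed sA′ tB s′ = (∀ i → tokens (s′ (i ↑ˡ b)) ≡ tokens (sA′ i) + onlyAt y 1 0 i) ×
                       (∀ i → job (s′ (i ↑ˡ b)) ≡ relabelJob (_↑ˡ b) (job (sA′ i))) ×
                       (∀ j → tokens (s′ (a ↑ʳ j)) ≡ tB j) × (∀ j → job (s′ (a ↑ʳ j)) ≡ free)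

    in-flight : ∀ r {s sA sA′} (cB : Fin b → Choice (a + b)) (tB : Fin b → ℕ) →
                (∀ j → Legal (a ↑ʳ j) (s (a ↑ʳ j)) (cB j)) →
                (∀ j → tokens (start tc tm (s (a ↑ʳ j)) (cB j)) ≡ tB j) →
                (∀ j → job (start tc tm (s (a ↑ʳ j)) (cB j)) ≡ sending (suc r) j) →
                Reaches tc tm sA (suc r) sA′ → Left.Embeds s sA →
                ∃ λ s′ → Reaches tc tm s (suc r) s′ × Landed sA′ tB s′
    in-flight zero {s} {sA} cB tB okB toks jobs (step cA okA done) s≅sA =
      next tc tm s R.c , step R.c (R.legal okA okB) done ,
      (λ i → trans (R.left-tokens i) (cong (_ +_) (arrives i))) , R.L.next-job , R.right-tokens ,
      (λ j → trans (R.right-job j) (onlyAt-same w j))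
      where
      module R = Round zero s sA cA cB tB s≅sA toks jobs
      arrives : ∀ i → delivers (i ↑ˡ b) (commJob (y ↑ˡ b) 1) ≡ onlyAt y 1 0 i
      arrives i = trans (delivers-relabel (_↑ˡ b) (↑ˡ-injective b) i (commJob y 1)) (delivers-arriving i y)
    in-flight (suc r) {s} {sA} cB tB okB toks jobs (step cA okA rA) s≅sA =
      step-∃ R.c (R.legal okA okB)
        (in-flight r (λ _ → idle) tB (λ _ → tt) R.right-tokens R.right-job rA
                   (λ i → trans (R.left-tokens i) (+-identityʳ _) , R.L.next-job i))
      where module R = Round (suc r) s sA cA cB tB s≅sA toks jobs

    send : ∀ {r s sA sA′ sB} → tm ≡ suc r → Reaches tc tm sA (suc r) sA′ →
           Left.Embeds s sA → Right.Embeds s sB → AllFree sB → 1 ≤ tokens (sB w) →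
           ∃ λ s′ → Reaches tc tm s (suc r) s′ × Landed sA′ (λ j → tokens (sB j) ∸ onlyAt w 1 0 j) s′
    send {r} {s} {sB = sB} tm≡ rA s≅sA s≅sB free-B 1≤ = in-flight r cB _ okB toks jobs rA s≅sA
      where
      cB : Fin b → Choice (a + b)
      cB = onlyAt w (comm (y ↑ˡ b)) idle
      okB : ∀ j → Legal (a ↑ʳ j) (s (a ↑ʳ j)) (cB j)
      okB j with w ≟ j
      ... | yes refl = trans (proj₂ (s≅sB w)) (cong (relabelJob (a ↑ʳ_)) (free-B w)) ,
                       subst (1 ≤_) (sym (proj₁ (s≅sB w))) 1≤ , ↑ˡ≢↑ʳ y w
      ... | no  _    = tt
      toks : ∀ j → tokens (start tc tm (s (a ↑ʳ j)) (cB j)) ≡ tokens (sB j) ∸ onlyAt w 1 0 j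
      toks j with w ≟ j
      ... | yes _ = cong (_∸ 1) (proj₁ (s≅sB j))
      ... | no  _ = proj₁ (s≅sB j)
      jobs : ∀ j → job (start tc tm (s (a ↑ʳ j)) (cB j)) ≡ sending (suc r) j
      jobs j with w ≟ j
      ... | yes _ = cong (commJob (y ↑ˡ b)) tm≡
      ... | no  _ = trans (proj₂ (s≅sB j)) (cong (relabelJob (a ↑ʳ_)) (free-B j))

    landed-ready : ∀ {sA′ tB s′} → Landed sA′ tB s′ → Final sA′ → sumFin b tB ≡ 0 → 1 ≤ tokens (sA′ y) →
                   AllFree s′ × 2 ≤ tokens (s′ (y ↑ˡ b)) × sumFin (a + b) (tokens ∘ s′) ≡ 2
    landed-ready {sA′} {tB} {s′} (tokens-A , jobs-A , tokens-B , jobs-B) (free-A , ΣA≡1) ΣtB≡0 1≤y =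
      ↑-elim _ (λ i → trans (jobs-A i) (cong (relabelJob (_↑ˡ b)) (free-A i))) jobs-B ,
      subst (2 ≤_) (sym (trans (tokens-A y) (cong (tokens (sA′ y) +_) (onlyAt-here y)))) (+-monoˡ-≤ 1 1≤y) ,
      (begin
        sumFin (a + b) (tokens ∘ s′)                                        ≡⟨ sumFin-++ a b (tokens ∘ s′) ⟩
        sumFin a (λ i → tokens (s′ (i ↑ˡ b))) + sumFin b (λ j → tokens (s′ (a ↑ʳ j)))
          ≡⟨ cong₂ _+_ (sumFin-cong a tokens-A) (trans (sumFin-cong b tokens-B) ΣtB≡0) ⟩
        sumFin a (λ i → tokens (sA′ i) + onlyAt y 1 0 i) + 0                ≡⟨ +-identityʳ _ ⟩
        sumFin a (λ i → tokens (sA′ i) + onlyAt y 1 0 i)                    ≡⟨ sumFin-+-onlyAt a (tokens ∘ sA′) y ⟩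
        sumFin a (tokens ∘ sA′) + 1                                         ≡⟨ cong (_+ 1) ΣA≡1 ⟩
        2 ∎)
      where open ≡-Reasoning

combine : ∀ tc′ tm′ {a b} k →
          Solvable (suc tc′) (suc tm′) a (k + suc tm′) → Solvable (suc tc′) (suc tm′) b k →
          Solvable (suc tc′) (suc tm′) (a + b) (k + (suc tm′ + suc tc′))
combine tc′ tm′ {a} {b} k (sA′ , rA , final-A@(_ , ΣA≡1)) (sB′ , rB , (free-B , ΣB≡1)) =
  let sA , rA₁ , rA₂          = Reaches-split k rA
      s₁ , r₁ , s₁≅sA , s₁≅sB′ = parallel k rA₁ rB (λ _ → refl , refl) (λ _ → refl , refl)
      y , 1≤y                 = sumFin-positive a (tokens ∘ sA′) (≤-reflexive (sym ΣA≡1))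
      w , 1≤w                 = sumFin-positive b (tokens ∘ sB′) (≤-reflexive (sym ΣB≡1))
      open Sending y w
      ΣtB≡0                   = +-cancelʳ-≡ 1 _ 0 (trans (sumFin-takeAt b (tokens ∘ sB′) w 1≤w) ΣB≡1)
      s₂ , r₂ , landed        = send refl rA₂ s₁≅sA s₁≅sB′ free-B 1≤w
      free₂ , 2≤ , Σ₂≡2       = landed-ready landed final-A ΣtB≡0 1≤y
      s₃ , r₃ , free₃ , Σ₃+1  = merge (suc tm′) (y ↑ˡ b) tc′ s₂ free₂ 2≤
  in  s₃ , Reaches-++ r₁ (Reaches-++ r₂ r₃) , free₃ , +-cancelʳ-≡ 1 _ 1 (trans Σ₃+1 Σ₂≡2)
  where open TwoParts (suc tc′) (suc tm′)

lemma3 : (tc tm : ℕ) → 1 ≤ tc → 1 ≤ tm → (R : ℕ) → tc + tm ≤ R →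
         (a b n : ℕ) → IsNStar tc tm (R ∸ tc) a → IsNStar tc tm (R ∸ tc ∸ tm) b →
         IsNStar tc tm R n → a + b ≤ n
lemma3 tc@(suc tc′) tm@(suc tm′) (s≤s z≤n) (s≤s z≤n) R tc+tm≤R a b n (solA , _) (solB , _) (_ , maximal) =
  maximal (a + b) (subst (Solvable tc tm (a + b)) k+tm+tc≡R
                         (combine tc′ tm′ k (subst (Solvable tc tm a) (sym k+tm≡R∸tc) solA) solB))
  where
  k : ℕ
  k = R ∸ tc ∸ tm
  k+tm≡R∸tc : k + tm ≡ R ∸ tc
  k+tm≡R∸tc = m∸n+n≡m (m+n≤o⇒m≤o∸n tm (subst (_≤ R) (+-comm tc tm) tc+tm≤R))
  k+tm+tc≡R : k + (tm + tc) ≡ R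
  k+tm+tc≡R = trans (sym (+-assoc k tm tc))
                    (trans (cong (_+ tc) k+tm≡R∸tc) (m∸n+n≡m (m+n≤o⇒m≤o tc tc+tm≤R)))
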